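{- For any integer $r\ge 2$ and any integer $k$ with $2\le k\le r-1$, $\mu_k(P_r\boxtimes P_2)=k+3$.
   Context: $P_n$ is the path on $n$ vertices. The strong product $G\boxtimes H$ has vertex set $V(G)\times V(H)$, and $(g,h),(g',h')$ are adjacent if either ($g=g'$ and $hh'\in E(H)$), or ($h=h'$ and $gg'\in E(G)$), or ($gg'\in E(G)$ and $hh'\in E(H)$). For a graph $G$, a set $S\subseteq V(G)$ and an integer $k\ge 1$, two vertices $x,y$ are $S_k$-visible if there is a shortest $x,y$-path of length at most $k$ none of whose internal vertices lies in $S$. $S$ is a $k$-distance mutual-visibility set if every two vertices of $S$ are $S_k$-visible, and $\mu_k(G)$ is the maximum cardinality of such a set. -}

module Defs where

open import Level using (0ℓ)
open import Data.Nat using (ℕ; zero; suc; _≤_; _+_)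
open import Data.Fin using (Fin; toℕ)
open import Data.Product using (_×_; _,_; Σ; ∃; proj₁; proj₂)
open import Data.Sum using (_⊎_)
open import Data.Unit using (⊤)
open import Data.List using (List; length)
open import Data.List.Membership.Propositional using (_∈_; _∉_)
open import Data.List.Relation.Unary.Unique.Propositional using (Unique)
open import Relation.Binary.PropositionalEquality using (_≡_)

record Graph : Set₁ where
  field
    V   : Set
    Adj : V → V → Set
open Graph public

P : ℕ → Graph
V (P n) = Fin n
Adj (P n) i j = (suc (toℕ i) ≡ toℕ j) ⊎ (suc (toℕ j) ≡ toℕ i)

_⊠_ : Graph → Graph → Graph
V (G ⊠ H) = V G × V H
Adj (G ⊠ H) (g , h) (g′ , h′) =
    (g ≡ g′ × Adj H h h′)
  ⊎ (h ≡ h′ × Adj G g g′)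
  ⊎ (Adj G g g′ × Adj H h h′)

data Walk (G : Graph) : V G → V G → ℕ → Set where
  []  : ∀ {x} → Walk G x x 0
  _∷_ : ∀ {x y z n} → Adj G x y → Walk G y z n → Walk G x z (suc n)

IsShortest : (G : Graph) {x y : V G} {ℓ : ℕ} → Walk G x y ℓ → Set
IsShortest G {x} {y} {ℓ} _ = ∀ m → Walk G x y m → ℓ ≤ m

AvoidFrom : {G : Graph} → List (V G) → {x y : V G} {ℓ : ℕ} → Walk G x y ℓ → Set
AvoidFrom S [] = ⊤
AvoidFrom S (_∷_ {x = u} _ w) = (u ∉ S) × AvoidFrom S w

InternalAvoid : {G : Graph} → List (V G) → {x y : V G} {ℓ : ℕ} → Walk G x y ℓ → Set
InternalAvoid S [] = ⊤
InternalAvoid S (_ ∷ w) = AvoidFrom S w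

Visible : (G : Graph) → List (V G) → ℕ → V G → V G → Set
Visible G S k x y =
  Σ ℕ λ ℓ → Σ (Walk G x y ℓ) λ w → IsShortest G w × ℓ ≤ k × InternalAvoid S w

IsKDMV : (G : Graph) → ℕ → List (V G) → Set
IsKDMV G k S = Unique S × (∀ {x y} → x ∈ S → y ∈ S → Visible G S k x y)

MuK≡ : (G : Graph) → ℕ → ℕ → Set
MuK≡ G k m =
  (Σ (List (V G)) λ S → IsKDMV G k S × length S ≡ m)
  × (∀ S → IsKDMV G k S → length S ≤ m)

-- Let a and b be the extreme columns of a k-distance mutual-visibility set S.
-- A shortest path of length at most k joins a vertex of S in column a to one in
-- column b, so b − a ≤ k, and it crosses every column strictly between a and b
-- in a vertex outside S.  Hence S has at most two vertices in each of the
-- columns a and b and at most one in each of the b − a − 1 columns between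
-- them: |S| ≤ b − a + 3 ≤ k + 3.  Conversely, the bottom row over the columns
-- 0, …, k together with the top vertices of columns 0 and k is such a set of
-- size k + 3: two of its vertices in different columns are joined by a shortest
-- path whose interior runs along the top row strictly between columns 0 and k.
module Submission where

open import Defs
open import Data.Nat using (ℕ; zero; suc; pred; _≤_; _<_; _+_; _∸_; _⊓_; ∣_-_∣; z≤n; s≤s; s≤s⁻¹; z<s)
open import Data.Nat.Properties
open import Data.Fin using (Fin; zero; suc; toℕ; fromℕ; fromℕ<; inject≤)
open import Data.Fin.Properties using (toℕ-injective; toℕ<n; toℕ-fromℕ<; toℕ-fromℕ; toℕ-inject≤; inject≤-injective)
open import Data.Product using (_×_; _,_; proj₁; proj₂; Σ; ∃-syntax)
open import Data.Sum using (_⊎_; inj₁; inj₂)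
open import Data.Unit using (tt)
open import Data.List using (List; []; _∷_; length; tabulate)
open import Data.List.Properties using (length-removeAt′; length-tabulate; length-upTo)
open import Data.List.Extrema.Nat using (argmin; argmax; argmin-all; argmax-all; f[argmin]≤f[⊤]; f[argmin]≤f[xs]; f[⊥]≤f[argmax]; f[xs]≤f[argmax])
open import Data.List.Membership.Propositional using (_∈_; _∉_; _─_)
open import Data.List.Membership.Propositional.Properties using (∈-upTo⁺; ∈-tabulate⁻)
open import Data.List.Relation.Unary.Any using (here; there)
import Data.List.Relation.Unary.All as All
open import Data.List.Relation.Unary.All.Properties using (tabulate⁺)
open import Data.List.Relation.Unary.AllPairs using (_∷_)
open import Data.List.Relation.Unary.Unique.Propositional using (Unique)
import Data.List.Relation.Unary.Unique.Propositional.Properties as Unique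
open import Function using (_∘_)
open import Relation.Binary using (tri<; tri≈; tri>)
open import Relation.Binary.PropositionalEquality
open import Relation.Nullary using (yes; no; contradiction)

private
  variable
    A : Set
    G H : Graph
    r k m n : ℕ

∣n-1+n∣≡1 : ∀ n → ∣ n - suc n ∣ ≡ 1
∣n-1+n∣≡1 zero    = refl
∣n-1+n∣≡1 (suc n) = ∣n-1+n∣≡1 n

+≡⇒∣-∣≡ : ∀ {m n o} → m + n ≡ o → ∣ n - o ∣ ≡ m
+≡⇒∣-∣≡ {m} {n} refl = trans (cong ∣ n -_∣ (+-comm m n)) (∣m-m+n∣≡n n m)

<⇒∃suc+≡ : ∀ {m n} → m < n → ∃[ d ] suc d + m ≡ n
<⇒∃suc+≡ {m} m<n with d , e ← m≤n⇒∃[o]m+o≡n m<n = d , trans (+-comm (suc d) m) (trans (+-suc m d) e)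

∈-─⁺ : {x y : A} {ys : List A} (y∈ys : y ∈ ys) → x ∈ ys → x ≢ y → x ∈ ys ─ y∈ys
∈-─⁺ (here refl) (here refl) x≢y  = contradiction refl x≢y
∈-─⁺ (here refl) (there x∈ys) _   = x∈ys
∈-─⁺ (there _)   (here refl) _    = here refl
∈-─⁺ (there y∈ys) (there x∈ys) x≢y = there (∈-─⁺ y∈ys x∈ys x≢y)

InjectiveOn : List A → (A → ℕ) → Set
InjectiveOn xs f = ∀ {x y} → x ∈ xs → y ∈ xs → f x ≡ f y → x ≡ y

length-≤-injection : {f : A → ℕ} {ys : List ℕ} (xs : List A) → Unique xs → InjectiveOn xs f →
                     (∀ {x} → x ∈ xs → f x ∈ ys) → length xs ≤ length ys
length-≤-injection []       _            _   _    = z≤n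
length-≤-injection {f = f} {ys} (x ∷ xs) (x∉xs ∷ unique) inj into = begin
  suc (length xs)            ≤⟨ s≤s (length-≤-injection xs unique (λ p q → inj (there p) (there q)) into′) ⟩
  suc (length (ys ─ fx∈ys))  ≡⟨ length-removeAt′ ys _ ⟨
  length ys                  ∎
  where
  open ≤-Reasoning
  fx∈ys = into (here refl)
  into′ : ∀ {z} → z ∈ xs → f z ∈ ys ─ fx∈ys
  into′ z∈xs = ∈-─⁺ fx∈ys (into (there z∈xs))
                 (λ fz≡fx → All.lookup x∉xs z∈xs (inj (here refl) (there z∈xs) (sym fz≡fx)))

length-≤-injection-< : {f : A → ℕ} (xs : List A) → Unique xs → InjectiveOn xs f →
                       (∀ {x} → x ∈ xs → f x < m) → length xs ≤ m
length-≤-injection-< {m = m} xs unique inj bounded =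
  subst (length xs ≤_) (length-upTo m) (length-≤-injection xs unique inj (∈-upTo⁺ ∘ bounded))

module _ (f : A → ℕ) (s : A) (xs : List A) where

  argmin-∈ : argmin f s xs ∈ s ∷ xs
  argmin-∈ = argmin-all f (here refl) (All.tabulate there)

  argmax-∈ : argmax f s xs ∈ s ∷ xs
  argmax-∈ = argmax-all f (here refl) (All.tabulate there)

  argmin-≤ : ∀ {v} → v ∈ s ∷ xs → f (argmin f s xs) ≤ f v
  argmin-≤ (here refl) = f[argmin]≤f[⊤] {f = f} s xs
  argmin-≤ (there v∈xs) = All.lookup (f[argmin]≤f[xs] {f = f} s xs) v∈xs

  ≤-argmax : ∀ {v} → v ∈ s ∷ xs → f v ≤ f (argmax f s xs)
  ≤-argmax (here refl) = f[⊥]≤f[argmax] {f = f} s xs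
  ≤-argmax (there v∈xs) = All.lookup (f[xs]≤f[argmax] {f = f} s xs) v∈xs

walk₀⇒≡ : ∀ {x y} → Walk G x y 0 → x ≡ y
walk₀⇒≡ [] = refl

visible-refl : ∀ {S x} → Visible G S k x x
visible-refl = 0 , [] , (λ _ _ → z≤n) , z≤n , tt

visible-adjacent : ∀ {S x y} → x ≢ y → Adj G x y → 1 ≤ k → Visible G S k x y
visible-adjacent x≢y xy 1≤k = 1 , xy ∷ [] , shortest , 1≤k , tt
  where
  shortest : ∀ m → Walk _ _ _ m → 1 ≤ m
  shortest zero    w = contradiction (walk₀⇒≡ w) x≢y
  shortest (suc _) _ = s≤s z≤n

internalAvoid⇒avoidFrom : ∀ {S x y} (w : Walk G x y (suc n)) → x ∉ S → InternalAvoid S w → AvoidFrom S w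
internalAvoid⇒avoidFrom (_ ∷ _) x∉S avoid = x∉S , avoid

record Lipschitz (G : Graph) (f : V G → ℕ) : Set where
  constructor lipschitz
  field
    adjacent-≤1 : ∀ {u v} → Adj G u v → ∣ f u - f v ∣ ≤ 1

module _ {f : V G → ℕ} (f-lipschitz : Lipschitz G f) where
  open Lipschitz f-lipschitz

  lipschitz-step : ∀ {u v} → Adj G u v → f v ≤ suc (f u)
  lipschitz-step {u} {v} uv = begin
    f v                    ≤⟨ m≤n+∣n-m∣ (f v) (f u) ⟩
    f u + ∣ f u - f v ∣    ≤⟨ +-monoʳ-≤ (f u) (adjacent-≤1 uv) ⟩
    f u + 1                ≡⟨ +-comm (f u) 1 ⟩
    suc (f u)              ∎
    where open ≤-Reasoning

  distance≤length : ∀ {x y} → Walk G x y m → ∣ f x - f y ∣ ≤ m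
  distance≤length {x = x} []             = ≤-reflexive (∣n-n∣≡0 (f x))
  distance≤length {x = x} {y} (_∷_ {y = u} xu w) = begin
    ∣ f x - f y ∣                ≤⟨ ∣-∣-triangle (f x) (f u) (f y) ⟩
    ∣ f x - f u ∣ + ∣ f u - f y ∣  ≤⟨ +-mono-≤ (adjacent-≤1 xu) (distance≤length w) ⟩
    suc _                        ∎
    where open ≤-Reasoning

  ≤-distance⇒shortest : ∀ {x y} → m ≤ ∣ f x - f y ∣ → (w : Walk G x y m) → IsShortest G w
  ≤-distance⇒shortest m≤d _ _ w′ = ≤-trans m≤d (distance≤length w′)

  visible-via : ∀ {S x y} (w : Walk G x y m) → InternalAvoid S w →
                m ≤ ∣ f x - f y ∣ → m ≤ k → Visible G S k x y
  visible-via w avoid m≤d m≤k = _ , w , ≤-distance⇒shortest m≤d w , m≤k , avoid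

  visible⇒distance≤k : ∀ {S x y} → Visible G S k x y → ∣ f x - f y ∣ ≤ k
  visible⇒distance≤k (_ , w , _ , ℓ≤k , _) = ≤-trans (distance≤length w) ℓ≤k

  -- Discrete intermediate value theorem: the walk witnessing visibility takes
  -- the value c at an interior vertex, which therefore lies outside S.
  visible-crossing : ∀ {S x y c} → Visible G S k x y → f x < c → c < f y →
                     ∃[ v ] f v ≡ c × v ∉ S
  visible-crossing (_ , [] , _) x<c c<x = contradiction c<x (<-asym x<c)
  visible-crossing {S = S} {c = c} (_ , xu ∷ w , _ , _ , avoid) x<c c<y =
    crossing w avoid (≤-trans (lipschitz-step xu) x<c) c<y
    where
    crossing : ∀ {u y ℓ} (w : Walk G u y ℓ) → AvoidFrom S w → f u ≤ c → c < f y → ∃[ v ] f v ≡ c × v ∉ S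
    crossing []                    _            u≤c c<u = contradiction c<u (≤⇒≯ u≤c)
    crossing (_∷_ {x = u} uu′ w) (u∉S , avoid) u≤c c<y with f u ≟ c
    ... | yes fu≡c = u , fu≡c , u∉S
    ... | no  fu≢c = crossing w avoid (≤-trans (lipschitz-step uu′) (≤∧≢⇒< u≤c fu≢c)) c<y

P-adjacent-≤1 : ∀ {i j : Fin n} → Adj (P n) i j → ∣ toℕ i - toℕ j ∣ ≤ 1
P-adjacent-≤1 {i = i} (inj₁ e) = ≤-reflexive (trans (cong ∣ toℕ i -_∣ (sym e)) (∣n-1+n∣≡1 (toℕ i)))
P-adjacent-≤1 {i = i} {j} (inj₂ e) = ≤-reflexive (begin-equality
  ∣ toℕ i - toℕ j ∣      ≡⟨ cong ∣_- toℕ j ∣ e ⟨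
  ∣ suc (toℕ j) - toℕ j ∣ ≡⟨ ∣-∣-comm (suc (toℕ j)) (toℕ j) ⟩
  ∣ toℕ j - suc (toℕ j) ∣ ≡⟨ ∣n-1+n∣≡1 (toℕ j) ⟩
  1                      ∎)
  where open ≤-Reasoning

P-lipschitz : Lipschitz (P n) toℕ
P-lipschitz = lipschitz P-adjacent-≤1

P-irreflexive : ∀ {i j : Fin n} → Adj (P n) i j → i ≢ j
P-irreflexive (inj₁ e) refl = 1+n≢n e
P-irreflexive (inj₂ e) refl = 1+n≢n e

⊠-proj₁-lipschitz : ∀ {f} → Lipschitz G f → Lipschitz (G ⊠ H) (f ∘ proj₁)
⊠-proj₁-lipschitz {G = G} {H} {f} (lipschitz adjacent-≤1) = lipschitz step
  where
  step : ∀ {u v} → Adj (G ⊠ H) u v → ∣ f (proj₁ u) - f (proj₁ v) ∣ ≤ 1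
  step {g , _} (inj₁ (refl , _))   = ≤-trans (≤-reflexive (∣n-n∣≡0 (f g))) z≤n
  step (inj₂ (inj₁ (_ , gg′)))     = adjacent-≤1 gg′
  step (inj₂ (inj₂ (gg′ , _)))     = adjacent-≤1 gg′

Complete : Graph → Set
Complete H = ∀ h h′ → h ≡ h′ ⊎ Adj H h h′

⊠-adj-complete : Complete H → ∀ {g g′ h h′} → Adj G g g′ → Adj (G ⊠ H) (g , h) (g′ , h′)
⊠-adj-complete complete {h = h} {h′} gg′ with complete h h′
... | inj₁ refl = inj₂ (inj₁ (refl , gg′))
... | inj₂ hh′  = inj₂ (inj₂ (gg′ , hh′))

P₂-complete : Complete (P 2)
P₂-complete zero       zero       = inj₁ refl
P₂-complete zero       (suc zero) = inj₂ (inj₁ refl)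
P₂-complete (suc zero) zero       = inj₂ (inj₂ refl)
P₂-complete (suc zero) (suc zero) = inj₁ refl

two-of-three : (h h′ h″ : Fin 2) → h ≡ h′ ⊎ h″ ≡ h ⊎ h″ ≡ h′
two-of-three zero       zero       _          = inj₁ refl
two-of-three (suc zero) (suc zero) _          = inj₁ refl
two-of-three zero       (suc zero) zero       = inj₂ (inj₁ refl)
two-of-three zero       (suc zero) (suc zero) = inj₂ (inj₂ refl)
two-of-three (suc zero) zero       zero       = inj₂ (inj₂ refl)
two-of-three (suc zero) zero       (suc zero) = inj₂ (inj₁ refl)

Vertex : ℕ → Set
Vertex r = V (P r ⊠ P 2)

col : Fin r × A → ℕ
col = toℕ ∘ proj₁

col-lipschitz : Lipschitz (P r ⊠ H) col
col-lipschitz = ⊠-proj₁-lipschitz P-lipschitz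

row₀ row₁ : Fin 2
row₀ = zero
row₁ = suc zero

module Slots {S : List (Vertex r)} {a b : ℕ}
             (a≤col : ∀ {v} → v ∈ S → a ≤ col v)
             (col≤b : ∀ {v} → v ∈ S → col v ≤ b)
             (hole : ∀ {c} → a < c → c < b → ∃[ v ] col v ≡ c × v ∉ S) where

  -- An injection of S into {0, …, b − a + 2}: two slots for each of the columns
  -- a and b, one for every column between them, which its hole leaves with at
  -- most one vertex of S.
  slot : Vertex r → ℕ
  slot (i , h) with toℕ i ≟ a | toℕ i ≟ b
  ... | yes _ | _     = toℕ h
  ... | no _  | yes _ = suc (b ∸ a + toℕ h)
  ... | no _  | no _  = suc (toℕ i ∸ a)

  slot-< : ∀ {v} → v ∈ S → slot v < 3 + (b ∸ a)
  slot-< {i , h} v∈S with toℕ i ≟ a | toℕ i ≟ b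
  ... | yes _ | _     = ≤-trans (toℕ<n h) (m≤m+n 2 _)
  ... | no _  | yes _ = s≤s (s≤s (≤-trans (+-monoʳ-≤ (b ∸ a) (s≤s⁻¹ (toℕ<n h))) (≤-reflexive (+-comm (b ∸ a) 1))))
  ... | no _  | no _  = s≤s (s≤s (m≤n⇒m≤1+n (∸-monoˡ-≤ a (col≤b v∈S))))

  col-from-slot : ∀ {v} → v ∈ S → col v ≡ (a + pred (slot v)) ⊓ b
  col-from-slot {i , h} v∈S with toℕ i ≟ a | toℕ i ≟ b
  ... | yes c≡a | _ = begin
    toℕ i                       ≡⟨ c≡a ⟩
    a                           ≡⟨ m≤n⇒m⊓n≡m a≤b ⟨
    a ⊓ b                       ≡⟨ cong (_⊓ b) (+-identityʳ a) ⟨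
    (a + 0) ⊓ b                 ≡⟨ cong (λ t → (a + t) ⊓ b) (pred-toℕ h) ⟨
    (a + pred (toℕ h)) ⊓ b      ∎
    where
    open ≡-Reasoning
    a≤b = ≤-trans (a≤col v∈S) (col≤b v∈S)
    pred-toℕ : (h : Fin 2) → pred (toℕ h) ≡ 0
    pred-toℕ zero       = refl
    pred-toℕ (suc zero) = refl
  ... | no _ | yes c≡b = begin
    toℕ i                       ≡⟨ c≡b ⟩
    b                           ≡⟨ m≥n⇒m⊓n≡n (m≤m+n b (toℕ h)) ⟨
    (b + toℕ h) ⊓ b             ≡⟨ cong (λ t → (t + toℕ h) ⊓ b) (m+[n∸m]≡n a≤b) ⟨
    (a + (b ∸ a) + toℕ h) ⊓ b   ≡⟨ cong (_⊓ b) (+-assoc a (b ∸ a) (toℕ h)) ⟩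
    (a + (b ∸ a + toℕ h)) ⊓ b   ∎
    where
    open ≡-Reasoning
    a≤b = ≤-trans (a≤col v∈S) (col≤b v∈S)
  ... | no _ | no _ = begin
    toℕ i                       ≡⟨ m≤n⇒m⊓n≡m (col≤b v∈S) ⟨
    toℕ i ⊓ b                   ≡⟨ cong (_⊓ b) (m+[n∸m]≡n (a≤col v∈S)) ⟨
    (a + (toℕ i ∸ a)) ⊓ b       ∎
    where open ≡-Reasoning

  slot-injective-in-column : ∀ {i h h′} → (i , h) ∈ S → (i , h′) ∈ S → slot (i , h) ≡ slot (i , h′) → h ≡ h′
  slot-injective-in-column {i} {h} {h′} ih∈S ih′∈S eq with toℕ i ≟ a | toℕ i ≟ b
  ... | yes _ | _     = toℕ-injective eq
  ... | no _  | yes _ = toℕ-injective (+-cancelˡ-≡ (b ∸ a) _ _ (suc-injective eq))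
  ... | no c≢a | no c≢b
    with (j , h″) , j≡i , jh″∉S ← hole (≤∧≢⇒< (a≤col ih∈S) (c≢a ∘ sym)) (≤∧≢⇒< (col≤b ih∈S) c≢b)
    with refl ← toℕ-injective j≡i
    with two-of-three h h′ h″
  ... | inj₁ h≡h′        = h≡h′
  ... | inj₂ (inj₁ refl) = contradiction ih∈S jh″∉S
  ... | inj₂ (inj₂ refl) = contradiction ih′∈S jh″∉S

  slot-injective : InjectiveOn S slot
  slot-injective {i , h} {j , h′} v∈S w∈S eq
    with refl ← toℕ-injective (trans (col-from-slot v∈S) (trans (cong (λ s → (a + pred s) ⊓ b) eq) (sym (col-from-slot w∈S))))
    = cong (i ,_) (slot-injective-in-column v∈S w∈S eq)

  length-≤-span : Unique S → length S ≤ 3 + (b ∸ a)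
  length-≤-span unique = length-≤-injection-< S unique slot-injective slot-<

IsKDMV⇒length≤ : ∀ {S} → IsKDMV (P r ⊠ P 2) k S → length S ≤ k + 3
IsKDMV⇒length≤ {S = []} _ = z≤n
IsKDMV⇒length≤ {k = k} {S = s ∷ S′} (unique , visible) = begin
  length (s ∷ S′)      ≤⟨ length-≤-span unique ⟩
  3 + (col y ∸ col x)  ≤⟨ +-monoʳ-≤ 3 spread ⟩
  3 + k                ≡⟨ +-comm 3 k ⟩
  k + 3                ∎
  where
  open ≤-Reasoning
  x = argmin col s S′
  y = argmax col s S′
  xy-visible = visible (argmin-∈ col s S′) (argmax-∈ col s S′)
  spread : col y ∸ col x ≤ k
  spread = ≤-trans (m∸n≤∣m-n∣ (col y) (col x))
             (subst (_≤ k) (∣-∣-comm (col x) (col y)) (visible⇒distance≤k col-lipschitz xy-visible))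
  open Slots (argmin-≤ col s S′) (≤-argmax col s S′) (visible-crossing col-lipschitz xy-visible)

visible-same-column : ∀ {S} {x y : Vertex r} → 1 ≤ k → col x ≡ col y → Visible (P r ⊠ P 2) S k x y
visible-same-column {x = i , h} {j , h′} 1≤k i≡j with toℕ-injective i≡j | P₂-complete h h′
... | refl | inj₁ refl = visible-refl
... | refl | inj₂ hh′  = visible-adjacent (P-irreflexive hh′ ∘ cong proj₂) (inj₁ (refl , hh′)) 1≤k

adjacent-columns : ∀ {x y : Vertex r} → Adj (P r) (proj₁ x) (proj₁ y) → Adj (P r ⊠ P 2) x y
adjacent-columns {r} = ⊠-adj-complete {G = P r} P₂-complete

Row₁FreeBetween : List (Vertex r) → ℕ → ℕ → Set
Row₁FreeBetween S a b = ∀ {v} → proj₂ v ≡ row₁ → a < col v → col v < b → v ∉ S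

rightward : ∀ {S} d {x y : Vertex r} → suc d + col x ≡ col y → Row₁FreeBetween S (col x) (col y) →
            Σ (Walk (P r ⊠ P 2) x y (suc d)) (InternalAvoid S)
rightward zero e _ = adjacent-columns (inj₁ e) ∷ [] , tt
rightward {r} (suc d) {x} {y} e free =
  let w , avoid = rightward d {z} {y} col-z+d free-z in
  adjacent-columns (inj₁ (sym col-z)) ∷ w , internalAvoid⇒avoidFrom w z∉S avoid
  where
  z<y : suc (col x) < col y
  z<y = subst (suc (col x) <_) e (s≤s (m<n+m (col x) z<s))
  p : suc (col x) < r
  p = <-trans z<y (toℕ<n (proj₁ y))
  z : Vertex r
  z = fromℕ< p , row₁
  col-z : col z ≡ suc (col x)
  col-z = toℕ-fromℕ< p
  x<z : col x < col z
  x<z = subst (col x <_) (sym col-z) (n<1+n (col x))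
  z∉S = free refl x<z (subst (_< col y) (sym col-z) z<y)
  col-z+d : suc d + col z ≡ col y
  col-z+d = trans (cong (suc d +_) col-z) (trans (+-suc (suc d) (col x)) e)
  free-z : Row₁FreeBetween _ (col z) (col y)
  free-z v₁ z<v v<y = free v₁ (<-trans x<z z<v) v<y

leftward : ∀ {S} d {x y : Vertex r} → suc d + col y ≡ col x → Row₁FreeBetween S (col y) (col x) →
           Σ (Walk (P r ⊠ P 2) x y (suc d)) (InternalAvoid S)
leftward zero e _ = adjacent-columns (inj₂ e) ∷ [] , tt
leftward {r} (suc d) {x} {y} e free =
  let w , avoid = leftward d {z} {y} (sym col-z) free-z in
  adjacent-columns (inj₂ (trans (cong suc col-z) e)) ∷ w , internalAvoid⇒avoidFrom w z∉S avoid
  where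
  p : suc d + col y < r
  p = <-trans (subst (suc d + col y <_) e (n<1+n _)) (toℕ<n (proj₁ x))
  z : Vertex r
  z = fromℕ< p , row₁
  col-z : col z ≡ suc d + col y
  col-z = toℕ-fromℕ< p
  z<x : col z < col x
  z<x = subst (_< col x) (sym col-z) (subst (suc d + col y <_) e (n<1+n _))
  z∉S = free refl (subst (col y <_) (sym col-z) (m<n+m (col y) z<s)) z<x
  free-z : Row₁FreeBetween _ (col y) (col z)
  free-z v₁ y<v v<z = free v₁ y<v (<-trans v<z z<x)

module _ {S : List (Vertex r)}
         (col≤k : ∀ {v} → v ∈ S → col v ≤ k)
         (row₁-at-ends : ∀ {v} → v ∈ S → proj₂ v ≡ row₁ → col v ≡ 0 ⊎ col v ≡ k) where

  row₁-free : ∀ {a b} → b ≤ k → Row₁FreeBetween S a b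
  row₁-free b≤k v₁ a<v v<b v∈S with row₁-at-ends v∈S v₁
  ... | inj₁ v≡0 = m<n⇒n≢0 a<v v≡0
  ... | inj₂ v≡k = <-irrefl v≡k (<-≤-trans v<b b≤k)

  mutually-visible : 1 ≤ k → ∀ {x y} → x ∈ S → y ∈ S → Visible (P r ⊠ P 2) S k x y
  mutually-visible 1≤k {x} {y} x∈S y∈S with <-cmp (col x) (col y)
  ... | tri≈ _ x≡y _ = visible-same-column 1≤k x≡y
  ... | tri< x<y _ _ =
    let d , e = <⇒∃suc+≡ x<y
        w , avoid = rightward d e (row₁-free (col≤k y∈S))
    in visible-via col-lipschitz w avoid (≤-reflexive (sym (+≡⇒∣-∣≡ e)))
         (≤-trans (m≤m+n (suc d) (col x)) (≤-trans (≤-reflexive e) (col≤k y∈S)))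
  ... | tri> _ _ y<x =
    let d , e = <⇒∃suc+≡ y<x
        w , avoid = leftward d e (row₁-free (col≤k x∈S))
    in visible-via col-lipschitz w avoid (≤-reflexive (sym (trans (∣-∣-comm (col x) (col y)) (+≡⇒∣-∣≡ e))))
         (≤-trans (m≤m+n (suc d) (col y)) (≤-trans (≤-reflexive e) (col≤k x∈S)))

module Extremal {r k : ℕ} (k<r : k < r) where

  column : Fin (suc k) → Fin r
  column c = inject≤ c k<r

  toℕ-column≤k : ∀ c → toℕ (column c) ≤ k
  toℕ-column≤k c = subst (_≤ k) (sym (toℕ-inject≤ c k<r)) (s≤s⁻¹ (toℕ<n c))

  bottom : Fin (suc k) → Vertex r
  bottom c = column c , row₀

  extremal-set : List (Vertex r)
  extremal-set = (column zero , row₁) ∷ (column (fromℕ k) , row₁) ∷ tabulate bottom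

  extremal-set-length : length extremal-set ≡ k + 3
  extremal-set-length = trans (cong (2 +_) (length-tabulate bottom)) (+-comm 3 k)

  extremal-set-unique : 1 ≤ k → Unique extremal-set
  extremal-set-unique 1≤k =
       (corners-distinct All.∷ tabulate⁺ {f = bottom} (λ _ ())) ∷ tabulate⁺ {f = bottom} (λ _ ())
    ∷ Unique.tabulate⁺ {f = bottom} (inject≤-injective _ _ _ _ ∘ cong proj₁)
    where
    corners-distinct : (column zero , row₁) ≢ (column (fromℕ k) , row₁)
    corners-distinct eq = <⇒≢ 1≤k (begin
      0                      ≡⟨ toℕ-inject≤ zero k<r ⟨
      toℕ (column zero)      ≡⟨ cong (toℕ ∘ proj₁) eq ⟩
      toℕ (column (fromℕ k)) ≡⟨ toℕ-inject≤ (fromℕ k) k<r ⟩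
      toℕ (fromℕ k)          ≡⟨ toℕ-fromℕ k ⟩
      k                      ∎)
      where open ≡-Reasoning

  ∈-extremal-set⁻ : ∀ {v} → v ∈ extremal-set → col v ≤ k × (proj₂ v ≡ row₁ → col v ≡ 0 ⊎ col v ≡ k)
  ∈-extremal-set⁻ (here refl) = toℕ-column≤k zero , λ _ → inj₁ (toℕ-inject≤ zero k<r)
  ∈-extremal-set⁻ (there (here refl)) =
    toℕ-column≤k (fromℕ k) , λ _ → inj₂ (trans (toℕ-inject≤ (fromℕ k) k<r) (toℕ-fromℕ k))
  ∈-extremal-set⁻ (there (there v∈bottom)) with c , refl ← ∈-tabulate⁻ {f = bottom} v∈bottom = toℕ-column≤k c , λ ()

  extremal-set-isKDMV : 1 ≤ k → IsKDMV (P r ⊠ P 2) k extremal-set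
  extremal-set-isKDMV 1≤k =
    extremal-set-unique 1≤k ,
    mutually-visible (proj₁ ∘ ∈-extremal-set⁻) (proj₂ ∘ ∈-extremal-set⁻) 1≤k

μ-P⊠P₂ : 1 ≤ k → k < r → MuK≡ (P r ⊠ P 2) k (k + 3)
μ-P⊠P₂ 1≤k k<r = (extremal-set , extremal-set-isKDMV 1≤k , extremal-set-length) , λ _ → IsKDMV⇒length≤
  where open Extremal k<r

proposition2p2 : ∀ (r k : ℕ) → 2 ≤ r → 2 ≤ k → k ≤ r ∸ 1 →
                   MuK≡ (P r ⊠ P 2) k (k + 3)
proposition2p2 (suc r) k _ 2≤k k≤r = μ-P⊠P₂ (≤-trans (s≤s z≤n) 2≤k) (s≤s k≤r)
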